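{- Let $f_0,\dots,f_m\colon\{ -1,1\}^n\to\mathbb R$ and $g_0,\dots,g_n\colon\{ -1,1\}^m\to\mathbb R$ form a multilinear generalized polymorphism in which all functions are non-constant, $f_0,g_0$ depend on all their inputs, and $f_1,\dots,f_m,g_1,\dots,g_n$ are Boolean-like and balanced. Let $Z_\ell$ be a block. Then every inclusion-maximal set $S\in\mathrm{supp}(\hat f_0)$ that intersects $\mathrm{rows}(Z_\ell)$ contains $\mathrm{rows}_{\ge2}(Z_\ell)$.
   Context: A multilinear generalized polymorphism: functions $f_0,\dots,f_m\colon\{ -1,1\}^n\to\mathbb R$, $g_0,\dots,g_n\colon\{ -1,1\}^m\to\mathbb R$ with $f_0(g_1(z_{1\cdot}),\dots,g_n(z_{n\cdot}))=g_0(f_1(z_{\cdot1}),\dots,f_m(z_{\cdot m}))$ for all $z\in\{ -1,1\}^{[n]\times[m]}$, where $z_{i\cdot}=(z_{i1},\dots,z_{im})$, $z_{\cdot j}=(z_{1j},\dots,z_{nj})$. Functions are identified with multilinear expansions $f=\sum_S\hat f(S)\prod_{i\in S}x_i$; $\mathrm{supp}(\hat f)=\{S:\hat f(S)\ne0\}$; $\deg$ is the degree; $\mathrm{Dep}(f)$ the set of relevant coordinates; balanced means $\hat f(\emptyset)=0$. A dictator is a non-constant function depending on one coordinate. 2-valued-like: (a) $\deg f=1$ iff $f$ is a dictator; (b) if $f$ is not a dictator, every $w\in\mathrm{Dep}(f)$ lies in some $S\in\mathrm{supp}(\hat f)$ with $|S|\ge2$. Boolean-like: 2-valued-like and $\deg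 f=1$ iff $f=\pm x_i$ for some coordinate $i$. $Z_0\subseteq[n]\times[m]$ is the set of $(i,j)$ on which the composed function depends; the blocks $Z_1,\dots,Z_k$ are the connected components of the graph on $Z_0$ where distinct elements are adjacent iff they share the first or second coordinate. $\mathrm{rows}(W)$ is the projection of $W$ on the first coordinate; $\mathrm{rows}_{\ge2}(Z_\ell)=\{i\in\mathrm{rows}(Z_\ell):\deg g_i\ge2\}$. -}

module Defs where

open import Level using (0ℓ)
open import Data.Nat using (ℕ; zero; suc; _≤_)
open import Data.Fin using (Fin) renaming (zero to fz; suc to fs)
open import Data.Fin.Subset using (Subset; _∈_; _⊆_; ∣_∣; ⊥)
open import Data.Bool using (Bool; true; false; not)
open import Data.Vec using ([]; _∷_)
open import Data.List using (List; []; _∷_; map; _++_)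
open import Data.Product using (Σ; ∃; ∃-syntax; _×_; _,_)
open import Data.Sum using (_⊎_)
open import Relation.Nullary using (¬_)
open import Relation.Binary.PropositionalEquality using (_≡_)
open import Relation.Binary.Construct.Closure.ReflexiveTransitive using (Star)
open import Algebra.Structures using (IsCommutativeRing)
open import Relation.Binary.Structures using (IsStrictTotalOrder)
open import Function.Bundles using (_⇔_)

-- An axiomatic model of the real numbers: a Dedekind-complete ordered
-- field (unique up to isomorphism).  The theorem quantifies over it.

record Reals : Set₁ where
  infixl 6 _+_
  infixl 7 _*_
  field
    R      : Set
    0r 1r  : R
    _+_ _*_ : R → R → R
    -_     : R → R
    _<_    : R → R → Set
    isCommutativeRing : IsCommutativeRing _≡_ _+_ _*_ -_ 0r 1r
    0≢1    : ¬ (0r ≡ 1r)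
    inverse : ∀ x → ¬ (x ≡ 0r) → ∃[ y ] (x * y ≡ 1r)
    isStrictTotalOrder : IsStrictTotalOrder _≡_ _<_
    +-mono-< : ∀ {x y} z → x < y → (x + z) < (y + z)
    *-pos    : ∀ {x y} → 0r < x → 0r < y → 0r < (x * y)

  _≤r_ : R → R → Set
  x ≤r y = (x < y) ⊎ (x ≡ y)

  field
    complete : (P : R → Set) → ∃[ x ] P x → ∃[ u ] (∀ x → P x → x ≤r u) →
               ∃[ s ] ((∀ x → P x → x ≤r s) ×
                       (∀ u → (∀ x → P x → x ≤r u) → s ≤r u))

module _ (ℝ : Reals) where
  open Reals ℝ

  sgn : Bool → R
  sgn true  = 1r
  sgn false = - 1r

  allSubsets : (n : ℕ) → List (Subset n)
  allSubsets zero    = [] ∷ []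
  allSubsets (suc n) = map (false ∷_) (allSubsets n) ++ map (true ∷_) (allSubsets n)

  sumL : List R → R
  sumL []       = 0r
  sumL (x ∷ xs) = x + sumL xs

  monomial : ∀ {n} → Subset n → (Fin n → R) → R
  monomial []            x = 1r
  monomial (false ∷ S) x = monomial S (λ i → x (fs i))
  monomial (true  ∷ S) x = x fz * monomial S (λ i → x (fs i))

  -- A function {-1,1}^n → ℝ identified with its multilinear expansion,
  -- represented by its Fourier coefficients f̂ : Subset n → ℝ.
  MLPoly : ℕ → Set
  MLPoly n = Subset n → R

  eval : ∀ {n} → MLPoly n → (Fin n → R) → R
  eval {n} f x = sumL (map (λ S → f S * monomial S x) (allSubsets n))

  val : ∀ {n} → MLPoly n → (Fin n → Bool) → R
  val f z = eval f (λ i → sgn (z i))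

  flip : ∀ {n} → (Fin n → Bool) → Fin n → (Fin n → Bool)
  flip {n} z i j with Data.Fin._≟_ i j
  ... | Relation.Nullary.yes _ = not (z j)
  ... | Relation.Nullary.no _  = z j

  supp : ∀ {n} → MLPoly n → Subset n → Set
  supp f S = ¬ (f S ≡ 0r)

  IsDeg : ∀ {n} → MLPoly n → ℕ → Set
  IsDeg {n} f d = (∀ S → supp f S → ∣ S ∣ ≤ d) × (∃[ S ] (supp f S × ∣ S ∣ ≡ d))

  NonConstant : ∀ {n} → MLPoly n → Set
  NonConstant {n} f = ∃[ x ] ∃[ y ] ¬ (val f x ≡ val f y)

  Relevant : ∀ {n} → MLPoly n → Fin n → Set
  Relevant {n} f i = ∃[ z ] ¬ (val f z ≡ val f (flip z i))

  DependsOnAll : ∀ {n} → MLPoly n → Set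
  DependsOnAll {n} f = ∀ i → Relevant f i

  Balanced : ∀ {n} → MLPoly n → Set
  Balanced {n} f = f ⊥ ≡ 0r

  Dictator : ∀ {n} → MLPoly n → Set
  Dictator {n} f = NonConstant f × ∃[ i ] (∀ j → Relevant f j → j ≡ i)

  TwoValuedLike : ∀ {n} → MLPoly n → Set
  TwoValuedLike {n} f =
    (IsDeg f 1 ⇔ Dictator f) ×
    (¬ Dictator f → ∀ w → Relevant f w → ∃[ S ] (supp f S × w ∈ S × 2 ≤ ∣ S ∣))

  IsPmCoordinate : ∀ {n} → MLPoly n → Set
  IsPmCoordinate {n} f = ∃[ i ] ((∀ z → val f z ≡ sgn (z i)) ⊎ (∀ z → val f z ≡ - sgn (z i)))

  BooleanLike : ∀ {n} → MLPoly n → Set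
  BooleanLike {n} f = TwoValuedLike f × (IsDeg f 1 ⇔ IsPmCoordinate f)

  module Polymorphism {n m : ℕ} (F0 : MLPoly n) (F : Fin m → MLPoly n)
                      (G0 : MLPoly m) (G : Fin n → MLPoly m) where

    comp : (Fin n → Fin m → Bool) → R
    comp z = eval F0 (λ i → eval (G i) (λ j → sgn (z i j)))

    IsGenPolymorphism : Set
    IsGenPolymorphism = ∀ (z : Fin n → Fin m → Bool) →
      comp z ≡ eval G0 (λ j → eval (F j) (λ i → sgn (z i j)))

    Cell : Set
    Cell = Fin n × Fin m

    flip2 : (Fin n → Fin m → Bool) → Cell → (Fin n → Fin m → Bool)
    flip2 z (i , j) i' j' with Data.Fin._≟_ i i' | Data.Fin._≟_ j j'
    ... | Relation.Nullary.yes _ | Relation.Nullary.yes _ = not (z i' j')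
    ... | _ | _ = z i' j'

    Z0 : Cell → Set
    Z0 p = ∃[ z ] ¬ (comp z ≡ comp (flip2 z p))

    Adj : Cell → Cell → Set
    Adj (i , j) (i' , j') = Z0 (i , j) × Z0 (i' , j') × ¬ ((i , j) ≡ (i' , j')) ×
                            ((i ≡ i') ⊎ (j ≡ j'))

    -- the block (connected component of Z₀) containing the cell p₀ ∈ Z₀
    InBlock : Cell → Cell → Set
    InBlock p₀ q = Z0 q × Star Adj p₀ q

    rows : Cell → Fin n → Set
    rows p₀ i = ∃[ j ] InBlock p₀ (i , j)

    rows≥2 : Cell → Fin n → Set
    rows≥2 p₀ i = rows p₀ i × ∃[ d ] (IsDeg (G i) d × 2 ≤ d)

-- Expanding the composed function on {-1,1}^{[n]×[m]} once row by row (through f₀ and the gᵢ) and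
-- once column by column (through g₀ and the fⱼ) gives two formulas for the same Fourier coefficients.
-- When all inner functions are balanced they say: a set U of cells has a nonzero coefficient iff
-- f̂₀(rows U) ≠ 0 and ĝᵢ(Uᵢ) ≠ 0 for every nonempty row i, iff ĝ₀(cols U) ≠ 0 and f̂ⱼ(Uʲ) ≠ 0 for every
-- nonempty column j.  Passing between the two descriptions, a nonempty row (column) of such a U may be
-- replaced by any other nonempty set with nonzero coefficient in that gᵢ (fⱼ).  Start with a U whose row set is the maximal support set S and
-- whose row a ∈ S meets column b with (a, b) ∈ Z₀.  If (a′, b) ∈ Z₀ and g_{a′} is not a dictator, g_{a′}
-- has a support set of size ≥ 2 through b, and three replacements produce a supported U′ with row set
-- S ∪ {a′}; maximality gives a′ ∈ S.  Two Z₀-cells in one row make the g of that row depend on two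
-- coordinates, so this propagates through the whole block.

module Submission where

open import Defs
open import Data.Nat using (ℕ; zero; suc; _≤_)
open import Data.Nat.Properties using (≤-trans; n≮n)
open import Data.Fin using (Fin; _≟_) renaming (zero to fz; suc to fs)
open import Data.Fin.Subset using (Subset; _∈_; _∉_; _⊆_; _∪_; ⊥; ⁅_⁆; inside; outside; ∣_∣)
open import Data.Fin.Subset.Properties
  using (anySubset?; _∈?_; drop-there; x∈⁅x⁆; ∣⁅x⁆∣≡1; p⊆q⇒∣p∣≤∣q∣)
import Data.Fin.Properties as Fin
open import Data.Bool.Properties using (∨-zeroʳ; ∧-zeroʳ; ¬-not)
open import Data.Bool using (Bool; true; false; not; _∧_; _∨_; if_then_else_)
open import Data.Vec using (Vec; []; _∷_; lookup; here; there; _[_]≔_; _[_]=_)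
import Data.Vec as Vec
open import Data.Vec.Properties
  using (lookup-replicate; lookup-zipWith; lookup-map; lookup∘tabulate; lookup⇒[]=; []=⇒lookup;
         lookup∘update; lookup∘update′; map-[]≔; []≔-lookup; []≔-idempotent; []≔-minimal; []≔-updates)
open import Data.Vec.Relation.Binary.Pointwise.Extensional using (ext; Pointwise-≡⇒≡)
open import Data.Vec.Functional using (head; tail) renaming (_∷_ to _◂_)
open import Data.List using (List; []; _∷_; map; _++_)
import Data.List.Properties as List
open import Data.Product using (Σ-syntax; ∃-syntax; _×_; _,_; proj₁; proj₂)
open import Data.Sum using (inj₁; inj₂)
import Data.Sum as Sum
open import Data.Empty using (⊥-elim)
open import Function using (id; _∘_; _⇔_; mk⇔; Equivalence)
open import Relation.Nullary using (¬_; Dec; yes; no; ¬?; _×-dec_)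
open import Relation.Nullary.Decidable using (decidable-stable)
open import Relation.Binary.PropositionalEquality
open import Relation.Binary.Definitions using (tri<; tri≈; tri>)
open import Relation.Binary.Structures using (IsStrictTotalOrder)
open import Relation.Binary.Construct.Closure.ReflexiveTransitive using (Star; ε; _◅_; reverse)
open import Algebra.Bundles using (CommutativeRing)
import Algebra.Properties.Group as GroupProperties

Maximal : ∀ {n} → (Subset n → Set) → Subset n → Set
Maximal P S = P S × (∀ T → P T → S ⊆ T → T ≡ S)

another-element : ∀ {m} (T : Subset m) → 2 ≤ ∣ T ∣ → ∀ b → ∃[ c ] (c ∈ T × c ≢ b)
another-element T 2≤∣T∣ b with Fin.any? (λ c → (c ∈? T) ×-dec ¬? (c ≟ b))
... | yes found = found
... | no  none  = ⊥-elim (n≮n 1 (≤-trans 2≤∣T∣ (subst (∣ T ∣ ≤_) (∣⁅x⁆∣≡1 b) (p⊆q⇒∣p∣≤∣q∣ T⊆⁅b⁆))))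
  where
  T⊆⁅b⁆ : T ⊆ ⁅ b ⁆
  T⊆⁅b⁆ {c} c∈T = subst (_∈ ⁅ b ⁆) (sym (decidable-stable (c ≟ b) (λ c≢b → none (c , c∈T , c≢b)))) (x∈⁅x⁆ b)

module Expansion (ℝ : Reals) where
  open Reals ℝ

  ring : CommutativeRing _ _
  ring = record { isCommutativeRing = isCommutativeRing }

  open CommutativeRing ring
    using (+-identityˡ; +-identityʳ; *-identityˡ; *-identityʳ; zeroˡ; zeroʳ;
           -‿inverseʳ; +-comm; *-comm; +-assoc; +-group; commutativeSemiring)
  open IsStrictTotalOrder isStrictTotalOrder using (compare; irrefl) renaming (_≟_ to _≟ᴿ_)
  open GroupProperties +-group using (∙-cancelˡ)
  open import Algebra.Solver.Ring.NaturalCoefficients.Default commutativeSemiring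
    using (solve; _:+_; _:*_; _:=_; con)
  open ≡-Reasoning

  1≢0 : 1r ≢ 0r
  1≢0 = 0≢1 ∘ sym

  *-≢0 : ∀ {x y} → x ≢ 0r → y ≢ 0r → x * y ≢ 0r
  *-≢0 {x} {y} x≢0 y≢0 xy≡0 with inverse x x≢0
  ... | x⁻¹ , xx⁻¹≡1 = y≢0 (begin
    y                  ≡⟨ sym (*-identityˡ y) ⟩
    1r * y             ≡⟨ cong (_* y) (sym xx⁻¹≡1) ⟩
    (x * x⁻¹) * y      ≡⟨ solve 3 (λ x x⁻¹ y → (x :* x⁻¹) :* y := x⁻¹ :* (x :* y)) refl x x⁻¹ y ⟩
    x⁻¹ * (x * y)      ≡⟨ cong (x⁻¹ *_) xy≡0 ⟩
    x⁻¹ * 0r           ≡⟨ zeroʳ x⁻¹ ⟩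
    0r                 ∎)

  *-≢0ˡ : ∀ {x y} → x * y ≢ 0r → x ≢ 0r
  *-≢0ˡ {y = y} xy≢0 x≡0 = xy≢0 (trans (cong (_* y) x≡0) (zeroˡ y))

  *-≢0ʳ : ∀ {x y} → x * y ≢ 0r → y ≢ 0r
  *-≢0ʳ {x} xy≢0 y≡0 = xy≢0 (trans (cong (x *_) y≡0) (zeroʳ x))

  double-< : ∀ {x y} → x < y → (x + x) < (y + y)
  double-< {x} {y} x<y = IsStrictTotalOrder.trans isStrictTotalOrder
    (+-mono-< x x<y) (subst (_< (y + y)) (+-comm x y) (+-mono-< y x<y))

  -- The order is used only here: an ordered field has characteristic ≠ 2.
  double-injective : ∀ {x y} → x + x ≡ y + y → x ≡ y
  double-injective {x} {y} 2x≡2y with compare x y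
  ... | tri< x<y _ _ = ⊥-elim (irrefl 2x≡2y (double-< x<y))
  ... | tri≈ _ x≡y _ = x≡y
  ... | tri> _ _ y<x = ⊥-elim (irrefl (sym 2x≡2y) (double-< y<x))

  ±-sum : ∀ a b → (a + 1r * b) + (a + (- 1r) * b) ≡ a + a
  ±-sum a b = begin
    (a + 1r * b) + (a + (- 1r) * b) ≡⟨ solve 4 (λ a b p q → (a :+ p :* b) :+ (a :+ q :* b) := (a :+ a) :+ (p :+ q) :* b)
                                               refl a b 1r (- 1r) ⟩
    (a + a) + (1r + - 1r) * b       ≡⟨ cong (λ c → (a + a) + c * b) (-‿inverseʳ 1r) ⟩
    (a + a) + 0r * b                ≡⟨ cong ((a + a) +_) (zeroˡ b) ⟩
    (a + a) + 0r                    ≡⟨ +-identityʳ (a + a) ⟩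
    a + a                           ∎

  ±-injective : ∀ {a b c d} → a + 1r * b ≡ c + 1r * d → a + (- 1r) * b ≡ c + (- 1r) * d → a ≡ c × b ≡ d
  ±-injective {a} {b} {c} {d} e₊ e₋ = a≡c , b≡d
    where
    a≡c : a ≡ c
    a≡c = double-injective (begin
      a + a                           ≡⟨ sym (±-sum a b) ⟩
      (a + 1r * b) + (a + (- 1r) * b) ≡⟨ cong₂ _+_ e₊ e₋ ⟩
      (c + 1r * d) + (c + (- 1r) * d) ≡⟨ ±-sum c d ⟩
      c + c                           ∎)
    b≡d : b ≡ d
    b≡d = begin
      b      ≡⟨ sym (*-identityˡ b) ⟩
      1r * b ≡⟨ ∙-cancelˡ a (1r * b) (1r * d) (trans e₊ (cong (_+ 1r * d) (sym a≡c))) ⟩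
      1r * d ≡⟨ *-identityˡ d ⟩
      d      ∎

  private variable
    m : ℕ

  ⟦_⟧ : MLPoly ℝ m → (Fin m → R) → R
  ⟦_⟧ = eval ℝ

  restrict₀ deriv₀ : MLPoly ℝ (suc m) → MLPoly ℝ m
  restrict₀ f S = f (outside ∷ S)
  deriv₀    f S = f (inside ∷ S)

  sum-++ : ∀ xs ys → sumL ℝ (xs ++ ys) ≡ sumL ℝ xs + sumL ℝ ys
  sum-++ []       ys = sym (+-identityˡ _)
  sum-++ (x ∷ xs) ys = trans (cong (x +_) (sum-++ xs ys)) (sym (+-assoc x _ _))

  sum-factor : ∀ {A : Set} (a b : A → R) (c : R) (xs : List A) →
    sumL ℝ (map (λ S → a S * (c * b S)) xs) ≡ c * sumL ℝ (map (λ S → a S * b S) xs)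
  sum-factor a b c []       = sym (zeroʳ c)
  sum-factor a b c (S ∷ xs) = trans (cong (a S * (c * b S) +_) (sum-factor a b c xs))
    (solve 4 (λ x y z w → x :* (y :* z) :+ y :* w := y :* (x :* z :+ w)) refl (a S) c (b S) _)

  eval-[] : (f : MLPoly ℝ 0) (x : Fin 0 → R) → ⟦ f ⟧ x ≡ f []
  eval-[] f x = solve 1 (λ a → a :* con 1 :+ con 0 := a) refl (f [])

  eval-∷ : (f : MLPoly ℝ (suc m)) (x : Fin (suc m) → R) →
    ⟦ f ⟧ x ≡ ⟦ restrict₀ f ⟧ (tail x) + head x * ⟦ deriv₀ f ⟧ (tail x)
  eval-∷ {m} f x = begin
      sumL ℝ (map term (map (outside ∷_) Ss ++ map (inside ∷_) Ss))
    ≡⟨ cong (sumL ℝ) (List.map-++ term (map (outside ∷_) Ss) _) ⟩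
      sumL ℝ (map term (map (outside ∷_) Ss) ++ map term (map (inside ∷_) Ss))
    ≡⟨ sum-++ (map term (map (outside ∷_) Ss)) _ ⟩
      sumL ℝ (map term (map (outside ∷_) Ss)) + sumL ℝ (map term (map (inside ∷_) Ss))
    ≡⟨ cong₂ _+_ (cong (sumL ℝ) (sym (List.map-∘ Ss))) (cong (sumL ℝ) (sym (List.map-∘ Ss))) ⟩
      sumL ℝ (map (term ∘ (outside ∷_)) Ss) + sumL ℝ (map (term ∘ (inside ∷_)) Ss)
    ≡⟨ cong (sumL ℝ (map (term ∘ (outside ∷_)) Ss) +_)
            (sum-factor (deriv₀ f) (λ S → monomial ℝ S (tail x)) (head x) Ss) ⟩
      ⟦ restrict₀ f ⟧ (tail x) + head x * ⟦ deriv₀ f ⟧ (tail x)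
    ∎
    where
    Ss = allSubsets ℝ m
    term = λ S → f S * monomial ℝ S x

  eval-cong : (f g : MLPoly ℝ m) (x y : Fin m → R) → (∀ S → f S ≡ g S) → (∀ i → x i ≡ y i) →
    ⟦ f ⟧ x ≡ ⟦ g ⟧ y
  eval-cong {zero}  f g x y f≗g x≗y = trans (eval-[] f x) (trans (f≗g []) (sym (eval-[] g y)))
  eval-cong {suc m} f g x y f≗g x≗y = begin
    ⟦ f ⟧ x                                                     ≡⟨ eval-∷ f x ⟩
    ⟦ restrict₀ f ⟧ (tail x) + head x * ⟦ deriv₀ f ⟧ (tail x)   ≡⟨ cong₂ _+_
        (eval-cong _ _ _ _ (f≗g ∘ (outside ∷_)) (x≗y ∘ fs))
        (cong₂ _*_ (x≗y fz) (eval-cong _ _ _ _ (f≗g ∘ (inside ∷_)) (x≗y ∘ fs))) ⟩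
    ⟦ restrict₀ g ⟧ (tail y) + head y * ⟦ deriv₀ g ⟧ (tail y)   ≡⟨ sym (eval-∷ g y) ⟩
    ⟦ g ⟧ y                                                     ∎

  eval-congˡ : ∀ {f g : MLPoly ℝ m} {x} → (∀ S → f S ≡ g S) → ⟦ f ⟧ x ≡ ⟦ g ⟧ x
  eval-congˡ f≗g = eval-cong _ _ _ _ f≗g (λ _ → refl)

  eval-congʳ : ∀ {f : MLPoly ℝ m} {x y} → (∀ i → x i ≡ y i) → ⟦ f ⟧ x ≡ ⟦ f ⟧ y
  eval-congʳ x≗y = eval-cong _ _ _ _ (λ _ → refl) x≗y

  eval-linear : ∀ (a b : R) (f g : MLPoly ℝ m) (x : Fin m → R) →
    ⟦ (λ S → a * f S + b * g S) ⟧ x ≡ a * ⟦ f ⟧ x + b * ⟦ g ⟧ x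
  eval-linear {zero} a b f g x =
    trans (eval-[] (λ S → a * f S + b * g S) x) (sym (cong₂ _+_ (cong (a *_) (eval-[] f x)) (cong (b *_) (eval-[] g x))))
  eval-linear {suc m} a b f g x = begin
      ⟦ (λ S → a * f S + b * g S) ⟧ x
    ≡⟨ eval-∷ _ x ⟩
      ⟦ (λ S → a * f₀ S + b * g₀ S) ⟧ x' + x₀ * ⟦ (λ S → a * f₁ S + b * g₁ S) ⟧ x'
    ≡⟨ cong₂ _+_ (eval-linear a b f₀ g₀ x') (cong (x₀ *_) (eval-linear a b f₁ g₁ x')) ⟩
      (a * ⟦ f₀ ⟧ x' + b * ⟦ g₀ ⟧ x') + x₀ * (a * ⟦ f₁ ⟧ x' + b * ⟦ g₁ ⟧ x')
    ≡⟨ solve 7 (λ a b F₀ G₀ F₁ G₁ y → (a :* F₀ :+ b :* G₀) :+ y :* (a :* F₁ :+ b :* G₁)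
                                   := a :* (F₀ :+ y :* F₁) :+ b :* (G₀ :+ y :* G₁))
             refl a b (⟦ f₀ ⟧ x') (⟦ g₀ ⟧ x') (⟦ f₁ ⟧ x') (⟦ g₁ ⟧ x') x₀ ⟩
      a * (⟦ f₀ ⟧ x' + x₀ * ⟦ f₁ ⟧ x') + b * (⟦ g₀ ⟧ x' + x₀ * ⟦ g₁ ⟧ x')
    ≡⟨ sym (cong₂ _+_ (cong (a *_) (eval-∷ f x)) (cong (b *_) (eval-∷ g x))) ⟩
      a * ⟦ f ⟧ x + b * ⟦ g ⟧ x
    ∎
    where
    x' = tail x
    x₀ = head x
    f₀ = restrict₀ f
    f₁ = deriv₀ f
    g₀ = restrict₀ g
    g₁ = deriv₀ g

  eval-scale : ∀ (a : R) (f : MLPoly ℝ m) (x : Fin m → R) → ⟦ (λ S → a * f S) ⟧ x ≡ a * ⟦ f ⟧ x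
  eval-scale a f x = begin
    ⟦ (λ S → a * f S) ⟧ x             ≡⟨ eval-congˡ (λ S → sym (trans (cong (a * f S +_) (zeroˡ (f S))) (+-identityʳ _))) ⟩
    ⟦ (λ S → a * f S + 0r * f S) ⟧ x  ≡⟨ eval-linear a 0r f f x ⟩
    a * ⟦ f ⟧ x + 0r * ⟦ f ⟧ x        ≡⟨ cong (a * ⟦ f ⟧ x +_) (zeroˡ _) ⟩
    a * ⟦ f ⟧ x + 0r                  ≡⟨ +-identityʳ _ ⟩
    a * ⟦ f ⟧ x                       ∎

  eval-0 : (x : Fin m → R) → ⟦ (λ _ → 0r) ⟧ x ≡ 0r
  eval-0 {zero}  x = eval-[] (λ _ → 0r) x
  eval-0 {suc m} x = trans (eval-∷ _ x) (trans (cong₂ _+_ (eval-0 (tail x)) (cong (head x *_) (eval-0 (tail x))))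
    (solve 1 (λ y → con 0 :+ y :* con 0 := con 0) refl (head x)))

  val-∷ : (f : MLPoly ℝ (suc m)) (b : Bool) (z : Fin m → Bool) →
    val ℝ f (b ◂ z) ≡ val ℝ (restrict₀ f) z + sgn ℝ b * val ℝ (deriv₀ f) z
  val-∷ f b z = eval-∷ f _

  val-≗-∷ : (f g : MLPoly ℝ (suc m)) → (∀ z → val ℝ f z ≡ val ℝ g z) →
    (∀ z → val ℝ (restrict₀ f) z ≡ val ℝ (restrict₀ g) z) × (∀ z → val ℝ (deriv₀ f) z ≡ val ℝ (deriv₀ g) z)
  val-≗-∷ f g f≗g = proj₁ ∘ halves , proj₂ ∘ halves
    where
    at : ∀ b z → val ℝ (restrict₀ f) z + sgn ℝ b * val ℝ (deriv₀ f) z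
               ≡ val ℝ (restrict₀ g) z + sgn ℝ b * val ℝ (deriv₀ g) z
    at b z = trans (sym (val-∷ f b z)) (trans (f≗g (b ◂ z)) (val-∷ g b z))
    halves = λ z → ±-injective (at true z) (at false z)

  eval-unique : (f g : MLPoly ℝ m) → (∀ z → val ℝ f z ≡ val ℝ g z) → ∀ S → f S ≡ g S
  eval-unique {zero} f g f≗g [] = begin
    f []           ≡⟨ sym (eval-[] f (λ ())) ⟩
    val ℝ f (λ ()) ≡⟨ f≗g (λ ()) ⟩
    val ℝ g (λ ()) ≡⟨ eval-[] g (λ ()) ⟩
    g []           ∎
  eval-unique {suc m} f g f≗g (outside ∷ S) = eval-unique _ _ (proj₁ (val-≗-∷ f g f≗g)) S
  eval-unique {suc m} f g f≗g (inside  ∷ S) = eval-unique _ _ (proj₂ (val-≗-∷ f g f≗g)) S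

  flip-other : (z : Fin m → Bool) {i j : Fin m} → i ≢ j → flip ℝ z i j ≡ z j
  flip-other z {i} {j} i≢j with i ≟ j
  ... | yes i≡j = ⊥-elim (i≢j i≡j)
  ... | no  _   = refl

  eval-independent : (f : MLPoly ℝ m) (w : Fin m) → (∀ S → w ∈ S → f S ≡ 0r) →
    (x y : Fin m → R) → (∀ j → j ≢ w → x j ≡ y j) → ⟦ f ⟧ x ≡ ⟦ f ⟧ y
  eval-independent {suc m} f fz vanish x y x≈y = begin
    ⟦ f ⟧ x                                                   ≡⟨ eval-∷ f x ⟩
    ⟦ restrict₀ f ⟧ (tail x) + head x * ⟦ deriv₀ f ⟧ (tail x) ≡⟨ cong₂ _+_
      (eval-congʳ (λ j → x≈y (fs j) (λ ())))
      (trans (cong (head x *_) (deriv≡0 (tail x))) (trans (zeroʳ (head x))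
        (sym (trans (cong (head y *_) (deriv≡0 (tail y))) (zeroʳ (head y)))))) ⟩
    ⟦ restrict₀ f ⟧ (tail y) + head y * ⟦ deriv₀ f ⟧ (tail y) ≡⟨ sym (eval-∷ f y) ⟩
    ⟦ f ⟧ y                                                   ∎
    where
    deriv≡0 : ∀ u → ⟦ deriv₀ f ⟧ u ≡ 0r
    deriv≡0 u = trans (eval-congˡ (λ S → vanish (inside ∷ S) here)) (eval-0 u)
  eval-independent {suc m} f (fs w) vanish x y x≈y = begin
    ⟦ f ⟧ x                                                   ≡⟨ eval-∷ f x ⟩
    ⟦ restrict₀ f ⟧ (tail x) + head x * ⟦ deriv₀ f ⟧ (tail x) ≡⟨ cong₂ _+_
      (eval-independent _ w (λ S → vanish (outside ∷ S) ∘ there) _ _ tail-x≈y)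
      (cong₂ _*_ (x≈y fz (λ ())) (eval-independent _ w (λ S → vanish (inside ∷ S) ∘ there) _ _ tail-x≈y)) ⟩
    ⟦ restrict₀ f ⟧ (tail y) + head y * ⟦ deriv₀ f ⟧ (tail y) ≡⟨ sym (eval-∷ f y) ⟩
    ⟦ f ⟧ y                                                   ∎
    where
    tail-x≈y : ∀ j → j ≢ w → x (fs j) ≡ y (fs j)
    tail-x≈y j j≢w = x≈y (fs j) (j≢w ∘ Fin.suc-injective)

  relevant⇒supported : (f : MLPoly ℝ m) (w : Fin m) → Relevant ℝ f w → ∃[ S ] (supp ℝ f S × w ∈ S)
  relevant⇒supported f w (z , z≉flip) with anySubset? (λ S → ¬? (f S ≟ᴿ 0r) ×-dec (w ∈? S))
  ... | yes found = found
  ... | no  none  = ⊥-elim (z≉flip (eval-independent f w vanish _ _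
                      (λ j j≢w → cong (sgn ℝ) (sym (flip-other z (j≢w ∘ sym))))))
    where
    vanish : ∀ S → w ∈ S → f S ≡ 0r
    vanish S w∈S = decidable-stable (f S ≟ᴿ 0r) (λ f≢0 → none (S , f≢0 , w∈S))

  nonconstant⇒supported : (f : MLPoly ℝ m) → NonConstant ℝ f → ∃[ S ] supp ℝ f S
  nonconstant⇒supported f (x , y , fx≢fy) with anySubset? (λ S → ¬? (f S ≟ᴿ 0r))
  ... | yes found = found
  ... | no  none  = ⊥-elim (fx≢fy (trans (val≡0 x) (sym (val≡0 y))))
    where
    val≡0 : ∀ z → val ℝ f z ≡ 0r
    val≡0 z = trans (eval-congˡ (λ S → decidable-stable (f S ≟ᴿ 0r) (none ∘ (S ,_))))
                    (eval-0 (sgn ℝ ∘ z))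

  two-relevant⇒¬dictator : (f : MLPoly ℝ m) {j j′ : Fin m} → Relevant ℝ f j → Relevant ℝ f j′ → j ≢ j′ → ¬ Dictator ℝ f
  two-relevant⇒¬dictator f j-rel j′-rel j≢j′ (_ , k , only-k) = j≢j′ (trans (only-k _ j-rel) (sym (only-k _ j′-rel)))

  deg≥2⇒¬dictator : (f : MLPoly ℝ m) → TwoValuedLike ℝ f → ∀ {d} → IsDeg ℝ f d → 2 ≤ d → ¬ Dictator ℝ f
  deg≥2⇒¬dictator f (deg1⇔dictator , _) (_ , S , fS≢0 , ∣S∣≡d) 2≤d dictator
    with Equivalence.from deg1⇔dictator dictator
  ... | (supp≤1 , _) = ⊥-elim (n≮n 1 (≤-trans 2≤d (subst (_≤ 1) ∣S∣≡d (supp≤1 S fS≢0))))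

  -- Expansions on {-1,1}^{[n]×[m]}; a cell set U ⊆ [n]×[m] is stored as its vector of rows
  private variable
    n : ℕ

  evalMatrix : (Vec (Subset m) n → R) → (Fin n → Fin m → R) → R
  evalMatrix {n = zero}  κ x = κ []
  evalMatrix {n = suc n} κ x = ⟦ (λ T → evalMatrix (κ ∘ (T ∷_)) (tail x)) ⟧ (head x)

  evalMatrix-linear : ∀ (a b : R) (κ κ′ : Vec (Subset m) n → R) (x : Fin n → Fin m → R) →
    evalMatrix (λ U → a * κ U + b * κ′ U) x ≡ a * evalMatrix κ x + b * evalMatrix κ′ x
  evalMatrix-linear {n = zero}  a b κ κ′ x = refl
  evalMatrix-linear {n = suc n} a b κ κ′ x = trans
    (eval-congˡ (λ T → evalMatrix-linear a b (κ ∘ (T ∷_)) (κ′ ∘ (T ∷_)) (tail x)))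
    (eval-linear a b _ _ (head x))

  evalMatrix-unique : (κ κ′ : Vec (Subset m) n → R) →
    (∀ (z : Fin n → Fin m → Bool) → evalMatrix κ (λ i j → sgn ℝ (z i j)) ≡ evalMatrix κ′ (λ i j → sgn ℝ (z i j))) →
    ∀ U → κ U ≡ κ′ U
  evalMatrix-unique {n = zero}  κ κ′ κ≈κ′ [] = κ≈κ′ (λ ())
  evalMatrix-unique {n = suc n} κ κ′ κ≈κ′ (T ∷ U) =
    evalMatrix-unique (κ ∘ (T ∷_)) (κ′ ∘ (T ∷_)) 
      (λ z → eval-unique (λ T → evalMatrix (κ ∘ (T ∷_)) (λ i j → sgn ℝ (z i j)))
                         (λ T → evalMatrix (κ′ ∘ (T ∷_)) (λ i j → sgn ℝ (z i j)))
                         (λ z₀ → κ≈κ′ (z₀ ◂ z)) T) U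

  nonempty : Subset m → Bool
  nonempty []      = false
  nonempty (b ∷ T) = b ∨ nonempty T

  𝟙 : MLPoly ℝ m
  𝟙 T = if nonempty T then 0r else 1r

  eval-𝟙 : (x : Fin m → R) → ⟦ 𝟙 ⟧ x ≡ 1r
  eval-𝟙 {zero}  x = eval-[] 𝟙 x
  eval-𝟙 {suc m} x = trans (eval-∷ 𝟙 x) (trans (cong₂ _+_ (eval-𝟙 (tail x)) (cong (head x *_) (eval-0 (tail x))))
    (solve 1 (λ y → con 1 :+ y :* con 0 := con 1) refl (head x)))

  rowCoeff : MLPoly ℝ n → (Fin n → MLPoly ℝ m) → Vec (Subset m) n → R
  rowCoeff P G []      = P []
  rowCoeff P G (T ∷ U) = 𝟙 T * rowCoeff (restrict₀ P) (tail G) U + G fz T * rowCoeff (deriv₀ P) (tail G) U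

  eval-∘-rows : (P : MLPoly ℝ n) (G : Fin n → MLPoly ℝ m) (x : Fin n → Fin m → R) →
    ⟦ P ⟧ (λ i → ⟦ G i ⟧ (x i)) ≡ evalMatrix (rowCoeff P G) x
  eval-∘-rows {n = zero}  P G x = eval-[] P (λ i → ⟦ G i ⟧ (x i))
  eval-∘-rows {n = suc n} P G x = begin
      ⟦ P ⟧ (λ i → ⟦ G i ⟧ (x i))
    ≡⟨ eval-∷ P _ ⟩
      ⟦ restrict₀ P ⟧ _ + y₀ * ⟦ deriv₀ P ⟧ _
    ≡⟨ cong₂ _+_ (eval-∘-rows (restrict₀ P) (tail G) (tail x))
                 (cong (y₀ *_) (eval-∘-rows (deriv₀ P) (tail G) (tail x))) ⟩
      E₀ + y₀ * E₁
    ≡⟨ solve 3 (λ E₀ y₀ E₁ → E₀ :+ y₀ :* E₁ := E₀ :* con 1 :+ E₁ :* y₀) refl E₀ y₀ E₁ ⟩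
      E₀ * 1r + E₁ * y₀
    ≡⟨ cong (λ c → E₀ * c + E₁ * y₀) (sym (eval-𝟙 (head x))) ⟩
      E₀ * ⟦ 𝟙 ⟧ (head x) + E₁ * ⟦ G fz ⟧ (head x)
    ≡⟨ sym (eval-linear E₀ E₁ 𝟙 (G fz) (head x)) ⟩
      ⟦ (λ T → E₀ * 𝟙 T + E₁ * G fz T) ⟧ (head x)
    ≡⟨ eval-congˡ (λ T → trans (cong₂ _+_ (*-comm E₀ (𝟙 T)) (*-comm E₁ (G fz T)))
                               (sym (evalMatrix-linear (𝟙 T) (G fz T) _ _ (tail x)))) ⟩
      evalMatrix (rowCoeff P G) x
    ∎
    where
    y₀ = ⟦ G fz ⟧ (head x)
    E₀ = evalMatrix (rowCoeff (restrict₀ P) (tail G)) (tail x)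
    E₁ = evalMatrix (rowCoeff (deriv₀ P) (tail G)) (tail x)

  _⊆ᵇ_ : Subset m → Subset m → Bool
  []      ⊆ᵇ []      = true
  (t ∷ T) ⊆ᵇ (s ∷ S) = (not t ∨ s) ∧ (T ⊆ᵇ S)

  above : MLPoly ℝ m → Subset m → MLPoly ℝ m
  above P T S = if T ⊆ᵇ S then P S else 0r

  eval-affine : (P : MLPoly ℝ m) (A B y : Fin m → R) →
    ⟦ P ⟧ (λ j → A j + y j * B j) ≡ ⟦ (λ T → ⟦ above P T ⟧ (λ j → if lookup T j then B j else A j)) ⟧ y
  eval-affine {zero} P A B y = trans (eval-[] P (λ ())) (sym (trans
    (eval-[] (λ T → ⟦ above P T ⟧ (λ j → if lookup T j then B j else A j)) y) (eval-[] (above P []) (λ ()))))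
  eval-affine {suc m} P A B y = begin
      ⟦ P ⟧ (λ j → A j + y j * B j)
    ≡⟨ eval-∷ P _ ⟩
      ⟦ restrict₀ P ⟧ _ + (A fz + y fz * B fz) * ⟦ deriv₀ P ⟧ _
    ≡⟨ cong₂ _+_ (eval-affine (restrict₀ P) (tail A) (tail B) (tail y))
                 (cong ((A fz + y fz * B fz) *_) (eval-affine (deriv₀ P) (tail A) (tail B) (tail y))) ⟩
      ⟦ Q₀ ⟧ (tail y) + (A fz + y fz * B fz) * ⟦ Q₁ ⟧ (tail y)
    ≡⟨ solve 5 (λ a b c d e → a :+ (b :+ c :* d) :* e := (con 1 :* a :+ b :* e) :+ c :* (d :* e))
             refl (⟦ Q₀ ⟧ (tail y)) (A fz) (y fz) (B fz) (⟦ Q₁ ⟧ (tail y)) ⟩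
      (1r * ⟦ Q₀ ⟧ (tail y) + A fz * ⟦ Q₁ ⟧ (tail y)) + y fz * (B fz * ⟦ Q₁ ⟧ (tail y))
    ≡⟨ sym (cong₂ _+_ (eval-linear 1r (A fz) Q₀ Q₁ (tail y)) (cong (y fz *_) (eval-scale (B fz) Q₁ (tail y)))) ⟩
      ⟦ (λ T → 1r * Q₀ T + A fz * Q₁ T) ⟧ (tail y) + y fz * ⟦ (λ T → B fz * Q₁ T) ⟧ (tail y)
    ≡⟨ cong₂ _+_ (eval-congˡ restrict₀-Q) (cong (y fz *_) (eval-congˡ deriv₀-Q)) ⟩
      ⟦ restrict₀ Q ⟧ (tail y) + y fz * ⟦ deriv₀ Q ⟧ (tail y)
    ≡⟨ sym (eval-∷ Q y) ⟩
      ⟦ Q ⟧ y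
    ∎
    where
    Q : MLPoly ℝ (suc m)
    Q T = ⟦ above P T ⟧ (λ j → if lookup T j then B j else A j)
    Q₀ Q₁ : MLPoly ℝ m
    Q₀ T = ⟦ above (restrict₀ P) T ⟧ (λ j → if lookup T j then tail B j else tail A j)
    Q₁ T = ⟦ above (deriv₀ P) T ⟧ (λ j → if lookup T j then tail B j else tail A j)
    restrict₀-Q : ∀ T → 1r * Q₀ T + A fz * Q₁ T ≡ restrict₀ Q T
    restrict₀-Q T = trans (cong (_+ A fz * Q₁ T) (*-identityˡ (Q₀ T))) (sym (eval-∷ (above P (outside ∷ T)) _))
    deriv₀-Q : ∀ T → B fz * Q₁ T ≡ deriv₀ Q T
    deriv₀-Q T = sym (begin
      deriv₀ Q T                        ≡⟨ eval-∷ (above P (inside ∷ T)) _ ⟩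
      ⟦ (λ _ → 0r) ⟧ x′ + B fz * Q₁ T   ≡⟨ cong (_+ B fz * Q₁ T) (eval-0 x′) ⟩
      0r + B fz * Q₁ T                  ≡⟨ +-identityˡ _ ⟩
      B fz * Q₁ T                       ∎)
      where
      x′ = λ j → if lookup T j then tail B j else tail A j

  colCoeff : MLPoly ℝ m → (Fin m → MLPoly ℝ n) → Vec (Subset m) n → R
  colCoeff P H []      = ⟦ P ⟧ (λ j → H j [])
  colCoeff P H (T ∷ U) = colCoeff (above P T) (λ j S → H j (lookup T j ∷ S)) U

  eval-∘-cols : (P : MLPoly ℝ m) (H : Fin m → MLPoly ℝ n) (x : Fin n → Fin m → R) →
    ⟦ P ⟧ (λ j → ⟦ H j ⟧ (λ i → x i j)) ≡ evalMatrix (colCoeff P H) x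
  eval-∘-cols {n = zero}  P H x = eval-congʳ (λ j → eval-[] (H j) (λ i → x i j))
  eval-∘-cols {n = suc n} P H x = begin
      ⟦ P ⟧ (λ j → ⟦ H j ⟧ (λ i → x i j))
    ≡⟨ eval-congʳ (λ j → eval-∷ (H j) _) ⟩
      ⟦ P ⟧ (λ j → A j + head x j * B j)
    ≡⟨ eval-affine P A B (head x) ⟩
      ⟦ (λ T → ⟦ above P T ⟧ (λ j → if lookup T j then B j else A j)) ⟧ (head x)
    ≡⟨ eval-cong _ _ _ _ (λ T → trans (eval-congʳ (λ j → select j (lookup T j)))
                                      (eval-∘-cols (above P T) (λ j S → H j (lookup T j ∷ S)) (tail x)))
                 (λ _ → refl) ⟩
      evalMatrix (colCoeff P H) x
    ∎
    where
    A B : Fin _ → R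
    A j = ⟦ restrict₀ (H j) ⟧ (λ i → tail x i j)
    B j = ⟦ deriv₀ (H j) ⟧ (λ i → tail x i j)
    select : ∀ j b → (if b then B j else A j) ≡ ⟦ (λ S → H j (b ∷ S)) ⟧ (λ i → tail x i j)
    select j true  = refl
    select j false = refl

  rowsOf : Vec (Subset m) n → Subset n
  rowsOf = Vec.map nonempty

  colsOf : Vec (Subset m) n → Subset m
  colsOf []      = ⊥
  colsOf (T ∷ U) = T ∪ colsOf U

  column : Vec (Subset m) n → Fin m → Subset n
  column U j = Vec.map (λ T → lookup T j) U

  setColumn : Vec (Subset m) n → Fin m → Subset n → Vec (Subset m) n
  setColumn U b X = Vec.zipWith (λ T x → T [ b ]≔ x) U X

  ∈⇒nonempty : ∀ {j} {T : Subset m} → j ∈ T → nonempty T ≡ true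
  ∈⇒nonempty here      = refl
  ∈⇒nonempty {T = b ∷ T} (there j∈T) = trans (cong (b ∨_) (∈⇒nonempty j∈T)) (∨-zeroʳ b)

  nonempty-⊥ : nonempty (⊥ {m}) ≡ false
  nonempty-⊥ {zero}  = refl
  nonempty-⊥ {suc m} = nonempty-⊥ {m}

  ¬nonempty⇒≡⊥ : (T : Subset m) → nonempty T ≡ false → T ≡ ⊥
  ¬nonempty⇒≡⊥ []            _  = refl
  ¬nonempty⇒≡⊥ (outside ∷ T) eq = cong (outside ∷_) (¬nonempty⇒≡⊥ T eq)

  supp⇒nonempty : (f : MLPoly ℝ m) → Balanced ℝ f → ∀ {T} → supp ℝ f T → nonempty T ≡ true
  supp⇒nonempty f f-bal {T} fT≢0 with nonempty T in eq
  ... | true  = refl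
  ... | false = ⊥-elim (fT≢0 (trans (cong f (¬nonempty⇒≡⊥ T eq)) f-bal))

  lookup-colsOf : (U : Vec (Subset m) n) (j : Fin m) → lookup (colsOf U) j ≡ nonempty (column U j)
  lookup-colsOf []      j = lookup-replicate j outside
  lookup-colsOf (T ∷ U) j = trans (lookup-zipWith _∨_ j T (colsOf U)) (cong (lookup T j ∨_) (lookup-colsOf U j))

  lookup-setColumn : (U : Vec (Subset m) n) (b : Fin m) (X : Subset n) (i : Fin n) →
    lookup (setColumn U b X) i ≡ lookup U i [ b ]≔ lookup X i
  lookup-setColumn U b X i = lookup-zipWith _ i U X

  lookup-column : (U : Vec (Subset m) n) (j : Fin m) (i : Fin n) → lookup (column U j) i ≡ lookup (lookup U i) j
  lookup-column U j i = lookup-map i (λ T → lookup T j) U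

  column-setColumn-same : (U : Vec (Subset m) n) (b : Fin m) (X : Subset n) → column (setColumn U b X) b ≡ X
  column-setColumn-same U b X = Pointwise-≡⇒≡ (ext λ i → begin
    lookup (column (setColumn U b X) b) i   ≡⟨ lookup-column (setColumn U b X) b i ⟩
    lookup (lookup (setColumn U b X) i) b   ≡⟨ cong (λ T → lookup T b) (lookup-setColumn U b X i) ⟩
    lookup (lookup U i [ b ]≔ lookup X i) b ≡⟨ lookup∘update b (lookup U i) (lookup X i) ⟩
    lookup X i                              ∎)

  column-setColumn-other : (U : Vec (Subset m) n) {b c : Fin m} (X : Subset n) → b ≢ c →
    column (setColumn U b X) c ≡ column U c
  column-setColumn-other U {b} {c} X b≢c = Pointwise-≡⇒≡ (ext λ i → begin
    lookup (column (setColumn U b X) c) i   ≡⟨ lookup-column (setColumn U b X) c i ⟩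
    lookup (lookup (setColumn U b X) i) c   ≡⟨ cong (λ T → lookup T c) (lookup-setColumn U b X i) ⟩
    lookup (lookup U i [ b ]≔ lookup X i) c ≡⟨ lookup∘update′ (b≢c ∘ sym) (lookup U i) (lookup X i) ⟩
    lookup (lookup U i) c                   ≡⟨ sym (lookup-column U c i) ⟩
    lookup (column U c) i                   ∎)

  rowsOf-update : (U : Vec (Subset m) n) (a : Fin n) (T : Subset m) → nonempty T ≡ nonempty (lookup U a) →
    rowsOf (U [ a ]≔ T) ≡ rowsOf U
  rowsOf-update U a T same = begin
    Vec.map nonempty (U [ a ]≔ T)                         ≡⟨ map-[]≔ nonempty U a ⟩
    rowsOf U [ a ]≔ nonempty T                            ≡⟨ cong (rowsOf U [ a ]≔_)
                                                                  (trans same (sym (lookup-map a nonempty U))) ⟩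
    rowsOf U [ a ]≔ lookup (rowsOf U) a                   ≡⟨ []≔-lookup (rowsOf U) a ⟩
    rowsOf U                                              ∎

  colsOf-setColumn : (U : Vec (Subset m) n) (b : Fin m) (X : Subset n) → nonempty X ≡ nonempty (column U b) →
    colsOf (setColumn U b X) ≡ colsOf U
  colsOf-setColumn U b X same = Pointwise-≡⇒≡ (ext λ c → begin
    lookup (colsOf (setColumn U b X)) c ≡⟨ lookup-colsOf (setColumn U b X) c ⟩
    nonempty (column (setColumn U b X) c) ≡⟨ nonempty-column c (b ≟ c) ⟩
    nonempty (column U c)               ≡⟨ sym (lookup-colsOf U c) ⟩
    lookup (colsOf U) c                 ∎)
    where
    nonempty-column : ∀ c → Dec (b ≡ c) → nonempty (column (setColumn U b X) c) ≡ nonempty (column U c)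
    nonempty-column c (yes refl) = trans (cong nonempty (column-setColumn-same U b X)) same
    nonempty-column c (no b≢c)   = cong nonempty (column-setColumn-other U X b≢c)

  ∈-rowsOf : (U : Vec (Subset m) n) {i : Fin n} → nonempty (lookup U i) ≡ true → i ∈ rowsOf U
  ∈-rowsOf U {i} ne = lookup⇒[]= i (rowsOf U) (trans (lookup-map i nonempty U) ne)

  ∈-colsOf : (U : Vec (Subset m) n) {j : Fin m} → nonempty (column U j) ≡ true → j ∈ colsOf U
  ∈-colsOf U {j} ne = lookup⇒[]= j (colsOf U) (trans (lookup-colsOf U j) ne)

  ∈-column : (U : Vec (Subset m) n) {i : Fin n} {j : Fin m} → j ∈ lookup U i → i ∈ column U j
  ∈-column U {i} {j} j∈Ui = lookup⇒[]= i (column U j) (trans (lookup-column U j i) ([]=⇒lookup j∈Ui))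

  ∈-rowsOf⁻ : (U : Vec (Subset m) n) {i : Fin n} → i ∈ rowsOf U → nonempty (lookup U i) ≡ true
  ∈-rowsOf⁻ U {i} i∈U = trans (sym (lookup-map i nonempty U)) ([]=⇒lookup i∈U)

  ∈-rowsOf-cong : (U V : Vec (Subset m) n) {i : Fin n} → lookup V i ≡ lookup U i → i ∈ rowsOf U → i ∈ rowsOf V
  ∈-rowsOf-cong U V Vi≡Ui i∈U = ∈-rowsOf V (trans (cong nonempty Vi≡Ui) (∈-rowsOf⁻ U i∈U))

  setColumn-restores : (U : Vec (Subset m) n) (b : Fin m) (X : Subset n) (a : Fin n) (T : Subset m) {d : Fin n} →
    a ≢ d → lookup (setColumn (setColumn U b X [ a ]≔ T) b (column U b)) d ≡ lookup U d
  setColumn-restores U b X a T {d} a≢d = begin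
    lookup (setColumn W′ b (column U b)) d                       ≡⟨ lookup-setColumn W′ b (column U b) d ⟩
    lookup W′ d [ b ]≔ lookup (column U b) d                     ≡⟨ cong₂ _[ b ]≔_ (lookup∘update′ (a≢d ∘ sym) W T)
                                                                                    (lookup-column U b d) ⟩
    lookup W d [ b ]≔ lookup (lookup U d) b                      ≡⟨ cong (_[ b ]≔ lookup (lookup U d) b)
                                                                         (lookup-setColumn U b X d) ⟩
    (lookup U d [ b ]≔ lookup X d) [ b ]≔ lookup (lookup U d) b  ≡⟨ []≔-idempotent (lookup U d) b ⟩
    lookup U d [ b ]≔ lookup (lookup U d) b                      ≡⟨ []≔-lookup (lookup U d) b ⟩
    lookup U d                                                   ∎
    where
    W  = setColumn U b X
    W′ = W [ a ]≔ T

  -- Closed forms of the coefficients when the inner functions are balanced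
  rowCoeff-closed : (P : MLPoly ℝ n) (G : Fin n → MLPoly ℝ m) → (∀ i → G i ⊥ ≡ 0r) →
    ∀ U → rowCoeff P G U ≡ P (rowsOf U) * monomial ℝ (rowsOf U) (λ i → G i (lookup U i))
  rowCoeff-closed P G G-bal []      = sym (*-identityʳ (P []))
  rowCoeff-closed P G G-bal (T ∷ U) with nonempty T in eq
  ... | false = begin
    1r * rc₀ + G fz T * rc₁ ≡⟨ cong (λ g → 1r * rc₀ + g * rc₁)
                                    (trans (cong (G fz) (¬nonempty⇒≡⊥ T eq)) (G-bal fz)) ⟩
    1r * rc₀ + 0r * rc₁     ≡⟨ solve 2 (λ a b → con 1 :* a :+ con 0 :* b := a) refl rc₀ rc₁ ⟩
    rc₀                     ≡⟨ rowCoeff-closed (restrict₀ P) (tail G) (G-bal ∘ fs) U ⟩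
    _                       ∎
    where
    rc₀ = rowCoeff (restrict₀ P) (tail G) U
    rc₁ = rowCoeff (deriv₀ P) (tail G) U
  ... | true  = begin
    0r * rc₀ + G fz T * rc₁     ≡⟨ cong (λ c → 0r * rc₀ + G fz T * c)
                                        (rowCoeff-closed (deriv₀ P) (tail G) (G-bal ∘ fs) U) ⟩
    0r * rc₀ + G fz T * (p * μ) ≡⟨ solve 4 (λ a g p μ → con 0 :* a :+ g :* (p :* μ) := p :* (g :* μ))
                                         refl rc₀ (G fz T) p μ ⟩
    p * (G fz T * μ)            ∎
    where
    rc₀ = rowCoeff (restrict₀ P) (tail G) U
    rc₁ = rowCoeff (deriv₀ P) (tail G) U
    p = deriv₀ P (rowsOf U)
    μ = monomial ℝ (rowsOf U) (λ i → G (fs i) (lookup U i))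

  ⊆ᵇ-∪ : (T C S : Subset m) → (T ∪ C) ⊆ᵇ S ≡ T ⊆ᵇ S ∧ C ⊆ᵇ S
  ⊆ᵇ-∪ []            []            []            = refl
  ⊆ᵇ-∪ (outside ∷ T) (outside ∷ C) (inside  ∷ S) = ⊆ᵇ-∪ T C S
  ⊆ᵇ-∪ (outside ∷ T) (inside  ∷ C) (inside  ∷ S) = ⊆ᵇ-∪ T C S
  ⊆ᵇ-∪ (inside  ∷ T) (outside ∷ C) (inside  ∷ S) = ⊆ᵇ-∪ T C S
  ⊆ᵇ-∪ (inside  ∷ T) (inside  ∷ C) (inside  ∷ S) = ⊆ᵇ-∪ T C S
  ⊆ᵇ-∪ (outside ∷ T) (outside ∷ C) (outside ∷ S) = ⊆ᵇ-∪ T C S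
  ⊆ᵇ-∪ (outside ∷ T) (inside  ∷ C) (outside ∷ S) = sym (∧-zeroʳ (T ⊆ᵇ S))
  ⊆ᵇ-∪ (inside  ∷ T) (c       ∷ C) (outside ∷ S) = refl

  ⊥⊆ᵇ : (S : Subset m) → ⊥ ⊆ᵇ S ≡ true
  ⊥⊆ᵇ []      = refl
  ⊥⊆ᵇ (s ∷ S) = ⊥⊆ᵇ S

  above-above : (P : MLPoly ℝ m) (T C S : Subset m) → above (above P T) C S ≡ above P (T ∪ C) S
  above-above P T C S rewrite ⊆ᵇ-∪ T C S with T ⊆ᵇ S | C ⊆ᵇ S
  ... | true  | true  = refl
  ... | true  | false = refl
  ... | false | true  = refl
  ... | false | false = refl

  colCoeff-above : (P : MLPoly ℝ m) (H : Fin m → MLPoly ℝ n) (U : Vec (Subset m) n) →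
    colCoeff P H U ≡ ⟦ above P (colsOf U) ⟧ (λ j → H j (column U j))
  colCoeff-above P H []      = eval-congˡ (λ S → cong (if_then P S else 0r) (sym (⊥⊆ᵇ S)))
  colCoeff-above P H (T ∷ U) = trans (colCoeff-above (above P T) (λ j S → H j (lookup T j ∷ S)) U)
                                     (eval-congˡ (above-above P T (colsOf U)))

  above-monomial : (P : MLPoly ℝ m) (C : Subset m) (w : Fin m → R) → (∀ j → j ∉ C → w j ≡ 0r) →
    ⟦ above P C ⟧ w ≡ P C * monomial ℝ C w
  above-monomial P [] w _ = trans (eval-[] (above P []) w) (sym (*-identityʳ (P [])))
  above-monomial P (outside ∷ C) w vanish = begin
      ⟦ above P (outside ∷ C) ⟧ w
    ≡⟨ eval-∷ (above P (outside ∷ C)) w ⟩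
      ⟦ above (restrict₀ P) C ⟧ (tail w) + w fz * ⟦ above (deriv₀ P) C ⟧ (tail w)
    ≡⟨ cong₂ (λ a b → a + b * ⟦ above (deriv₀ P) C ⟧ (tail w))
             (above-monomial (restrict₀ P) C (tail w) (λ j j∉C → vanish (fs j) (j∉C ∘ drop-there)))
             (vanish fz (λ ())) ⟩
      P (outside ∷ C) * monomial ℝ C (tail w) + 0r * ⟦ above (deriv₀ P) C ⟧ (tail w)
    ≡⟨ solve 2 (λ a b → a :+ con 0 :* b := a) refl _ _ ⟩
      P (outside ∷ C) * monomial ℝ (outside ∷ C) w
    ∎
  above-monomial {suc m} P (inside ∷ C) w vanish = begin
      ⟦ above P (inside ∷ C) ⟧ w
    ≡⟨ eval-∷ (above P (inside ∷ C)) w ⟩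
      ⟦ (λ _ → 0r) ⟧ (tail w) + w fz * ⟦ above (deriv₀ P) C ⟧ (tail w)
    ≡⟨ cong₂ (λ a b → a + w fz * b) (eval-0 (tail w))
             (above-monomial (deriv₀ P) C (tail w) (λ j j∉C → vanish (fs j) (j∉C ∘ drop-there))) ⟩
      0r + w fz * (P (inside ∷ C) * monomial ℝ C (tail w))
    ≡⟨ solve 3 (λ a b c → con 0 :+ a :* (b :* c) := b :* (a :* c)) refl _ _ _ ⟩
      P (inside ∷ C) * monomial ℝ (inside ∷ C) w
    ∎

  colCoeff-closed : (P : MLPoly ℝ m) (H : Fin m → MLPoly ℝ n) → (∀ j → H j ⊥ ≡ 0r) →
    ∀ U → colCoeff P H U ≡ P (colsOf U) * monomial ℝ (colsOf U) (λ j → H j (column U j))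
  colCoeff-closed P H H-bal U =
    trans (colCoeff-above P H U) (above-monomial P (colsOf U) _ vanish)
    where
    vanish : ∀ j → j ∉ colsOf U → H j (column U j) ≡ 0r
    vanish j j∉ = trans (cong (H j) (¬nonempty⇒≡⊥ (column U j) (trans (sym (lookup-colsOf U j))
                          (¬-not (j∉ ∘ lookup⇒[]= j (colsOf U))))))
                        (H-bal j)

  Supported : MLPoly ℝ m → Subset m → (Fin m → R) → Set
  Supported P S w = supp ℝ P S × (∀ {j} → j ∈ S → w j ≢ 0r)

  monomial≢0⇒ : (S : Subset m) (w : Fin m → R) → monomial ℝ S w ≢ 0r → ∀ {j} → j ∈ S → w j ≢ 0r
  monomial≢0⇒ (inside  ∷ S) w μ≢0 here        = *-≢0ˡ μ≢0
  monomial≢0⇒ (outside ∷ S) w μ≢0 (there j∈S) = monomial≢0⇒ S (tail w) μ≢0 j∈S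
  monomial≢0⇒ (inside  ∷ S) w μ≢0 (there j∈S) = monomial≢0⇒ S (tail w) (*-≢0ʳ μ≢0) j∈S

  monomial≢0⇐ : (S : Subset m) (w : Fin m → R) → (∀ {j} → j ∈ S → w j ≢ 0r) → monomial ℝ S w ≢ 0r
  monomial≢0⇐ []            w w≢0 = 1≢0
  monomial≢0⇐ (outside ∷ S) w w≢0 = monomial≢0⇐ S (tail w) (w≢0 ∘ there)
  monomial≢0⇐ (inside  ∷ S) w w≢0 = *-≢0 (w≢0 here) (monomial≢0⇐ S (tail w) (w≢0 ∘ there))

  coeff*monomial≢0⇔Supported : (P : MLPoly ℝ m) (S : Subset m) (w : Fin m → R) →
    P S * monomial ℝ S w ≢ 0r ⇔ Supported P S w
  coeff*monomial≢0⇔Supported P S w = mk⇔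
    (λ ≢0 → *-≢0ˡ ≢0 , λ {j} → monomial≢0⇒ S w (*-≢0ʳ ≢0) {j})
    (λ (supported : Supported P S w) → *-≢0 (proj₁ supported) (monomial≢0⇐ S w (proj₂ supported)))

  Supported-update : ∀ {P : MLPoly ℝ m} {S S′ w w′} (k : Fin m) → Supported P S w → S′ ≡ S →
    w′ k ≢ 0r → (∀ j → k ≢ j → w′ j ≡ w j) → Supported P S′ w′
  Supported-update {S′ = S′} {w′ = w′} k (P≢0 , w≢0) refl w′k≢0 w′≗w = P≢0 , w′≢0
    where
    w′≢0 : ∀ {j} → j ∈ S′ → w′ j ≢ 0r
    w′≢0 {j} j∈S with k ≟ j
    ... | yes refl = w′k≢0
    ... | no  k≢j  = w≢0 j∈S ∘ trans (sym (w′≗w j k≢j))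

  RowSupported : MLPoly ℝ n → (Fin n → MLPoly ℝ m) → Vec (Subset m) n → Set
  RowSupported P G U = Supported P (rowsOf U) (λ i → G i (lookup U i))

  ColSupported : MLPoly ℝ m → (Fin m → MLPoly ℝ n) → Vec (Subset m) n → Set
  ColSupported P H U = Supported P (colsOf U) (λ j → H j (column U j))

  rowCoeff≢0⇔RowSupported : (P : MLPoly ℝ n) (G : Fin n → MLPoly ℝ m) → (∀ i → G i ⊥ ≡ 0r) →
    ∀ U → rowCoeff P G U ≢ 0r ⇔ RowSupported P G U
  rowCoeff≢0⇔RowSupported P G G-bal U rewrite rowCoeff-closed P G G-bal U =
    coeff*monomial≢0⇔Supported P (rowsOf U) _

  colCoeff≢0⇔ColSupported : (P : MLPoly ℝ m) (H : Fin m → MLPoly ℝ n) → (∀ j → H j ⊥ ≡ 0r) →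
    ∀ U → colCoeff P H U ≢ 0r ⇔ ColSupported P H U
  colCoeff≢0⇔ColSupported P H H-bal U rewrite colCoeff-closed P H H-bal U =
    coeff*monomial≢0⇔Supported P (colsOf U) _

  RowSupported-update : (P : MLPoly ℝ n) (G : Fin n → MLPoly ℝ m) (U : Vec (Subset m) n) (a : Fin n) (T : Subset m) →
    RowSupported P G U → nonempty T ≡ nonempty (lookup U a) → G a T ≢ 0r → RowSupported P G (U [ a ]≔ T)
  RowSupported-update P G U a T U-supp same Ga≢0 = Supported-update {P = P} a U-supp (rowsOf-update U a T same)
    (λ Ga≡0 → Ga≢0 (trans (cong (G a) (sym (lookup∘update a U T))) Ga≡0))
    (λ d a≢d → cong (G d) (lookup∘update′ (a≢d ∘ sym) U T))

  ColSupported-setColumn : (P : MLPoly ℝ m) (H : Fin m → MLPoly ℝ n) (U : Vec (Subset m) n) (b : Fin m) (X : Subset n) →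
    ColSupported P H U → nonempty X ≡ nonempty (column U b) → H b X ≢ 0r → ColSupported P H (setColumn U b X)
  ColSupported-setColumn P H U b X U-supp same Hb≢0 = Supported-update {P = P} b U-supp (colsOf-setColumn U b X same)
    (λ Hb≡0 → Hb≢0 (trans (cong (H b) (sym (column-setColumn-same U b X))) Hb≡0))
    (λ c b≢c → cong (H c) (column-setColumn-other U X b≢c))

  RowSupported-with-rows : (P : MLPoly ℝ n) (G : Fin n → MLPoly ℝ m) (S : Subset n) → supp ℝ P S →
    (∀ i → Σ[ T ∈ Subset m ] (supp ℝ (G i) T × nonempty T ≡ true)) →
    Σ[ U ∈ Vec (Subset m) n ] (RowSupported P G U × rowsOf U ≡ S)
  RowSupported-with-rows {m = m} P G S PS≢0 row = U , (subst (supp ℝ P) (sym rows≡S) PS≢0 , G≢0) , rows≡S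
    where
    entry : Fin _ → Bool → Subset m
    entry i true  = proj₁ (row i)
    entry i false = ⊥
    nonempty-entry : ∀ i s → nonempty (entry i s) ≡ s
    nonempty-entry i true  = proj₂ (proj₂ (row i))
    nonempty-entry i false = nonempty-⊥ {m}
    U = Vec.tabulate (λ i → entry i (lookup S i))
    lookup-U : ∀ i → lookup U i ≡ entry i (lookup S i)
    lookup-U = lookup∘tabulate _
    rows≡S : rowsOf U ≡ S
    rows≡S = Pointwise-≡⇒≡ (ext λ i →
      trans (lookup-map i nonempty U) (trans (cong nonempty (lookup-U i)) (nonempty-entry i (lookup S i))))
    G≢0 : ∀ {i} → i ∈ rowsOf U → G i (lookup U i) ≢ 0r
    G≢0 {i} i∈rows rewrite lookup-U i | []=⇒lookup (subst (i ∈_) rows≡S i∈rows) = proj₁ (proj₂ (row i))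

  RowSupported-through : (P : MLPoly ℝ n) (G : Fin n → MLPoly ℝ m) (S : Subset n) → supp ℝ P S →
    (∀ i → Σ[ T ∈ Subset m ] (supp ℝ (G i) T × nonempty T ≡ true)) →
    ∀ {a T} → a ∈ S → supp ℝ (G a) T → nonempty T ≡ true →
    Σ[ U ∈ Vec (Subset m) n ] (RowSupported P G U × rowsOf U ≡ S × lookup U a ≡ T)
  RowSupported-through P G S PS≢0 row {a} {T} a∈S GT≢0 T≢∅
    with RowSupported-with-rows P G S PS≢0 row
  ... | U₀ , U₀-row , U₀-rows =
    U₀ [ a ]≔ T , RowSupported-update P G U₀ a T U₀-row same GT≢0 ,
    trans (rowsOf-update U₀ a T same) U₀-rows , lookup∘update a U₀ T
    where
    same : nonempty T ≡ nonempty (lookup U₀ a)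
    same = trans T≢∅ (sym (∈-rowsOf⁻ U₀ (subst (a ∈_) (sym U₀-rows) a∈S)))

module Polymorphic (ℝ : Reals) {n m : ℕ}
  (F0 : MLPoly ℝ n) (F : Fin m → MLPoly ℝ n) (G0 : MLPoly ℝ m) (G : Fin n → MLPoly ℝ m) where
  open Reals ℝ
  open Expansion ℝ
  open Polymorphism ℝ F0 F G0 G
  open ≡-Reasoning

  flip2-row : ∀ z a b j → flip2 z (a , b) a j ≡ flip ℝ (z a) b j
  flip2-row z a b j with a ≟ a | b ≟ j
  ... | yes _   | yes _ = refl
  ... | yes _   | no  _ = refl
  ... | no  a≢a | _     = ⊥-elim (a≢a refl)

  flip2-col : ∀ z a b i → flip2 z (a , b) i b ≡ flip ℝ (λ i → z i b) a i
  flip2-col z a b i with a ≟ i | b ≟ b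
  ... | yes _ | yes _   = refl
  ... | no  _ | yes _   = refl
  ... | _     | no  b≢b = ⊥-elim (b≢b refl)

  flip2-other-row : ∀ z {a} b {i} j → a ≢ i → flip2 z (a , b) i j ≡ z i j
  flip2-other-row z {a} b {i} j a≢i with a ≟ i | b ≟ j
  ... | yes a≡i | _     = ⊥-elim (a≢i a≡i)
  ... | no  _   | yes _ = refl
  ... | no  _   | no  _ = refl

  flip2-other-col : ∀ z a {b} i {j} → b ≢ j → flip2 z (a , b) i j ≡ z i j
  flip2-other-col z a {b} i {j} b≢j with a ≟ i | b ≟ j
  ... | _     | yes b≡j = ⊥-elim (b≢j b≡j)
  ... | yes _ | no  _   = refl
  ... | no  _ | no  _   = refl

  Z0⇒row-relevant : ∀ {a b} → Z0 (a , b) → Relevant ℝ (G a) b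
  Z0⇒row-relevant {a} {b} (z , comp≢) = z a , λ same → comp≢ (eval-congʳ (λ i → rows-agree same i (a ≟ i)))
    where
    rows-agree : val ℝ (G a) (z a) ≡ val ℝ (G a) (flip ℝ (z a) b) →
      ∀ i → Dec (a ≡ i) → ⟦ G i ⟧ (λ j → sgn ℝ (z i j)) ≡ ⟦ G i ⟧ (λ j → sgn ℝ (flip2 z (a , b) i j))
    rows-agree same i (yes refl) = trans same (eval-congʳ (λ j → cong (sgn ℝ) (sym (flip2-row z a b j))))
    rows-agree same i (no a≢i)   = eval-congʳ (λ j → cong (sgn ℝ) (sym (flip2-other-row z b j a≢i)))

  Adj-sym : ∀ {p q} → Adj p q → Adj q p
  Adj-sym (p∈Z0 , q∈Z0 , p≢q , same) = q∈Z0 , p∈Z0 , p≢q ∘ sym , Sum.map sym sym same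

  module _ (polymorphism : IsGenPolymorphism) where

    Z0⇒col-relevant : ∀ {a b} → Z0 (a , b) → Relevant ℝ (F b) a
    Z0⇒col-relevant {a} {b} (z , comp≢) = (λ i → z i b) , λ same → comp≢ (begin
      comp z                                                          ≡⟨ polymorphism z ⟩
      ⟦ G0 ⟧ (λ j → ⟦ F j ⟧ (λ i → sgn ℝ (z i j)))                    ≡⟨ eval-congʳ (λ j → cols-agree same j (b ≟ j)) ⟩
      ⟦ G0 ⟧ (λ j → ⟦ F j ⟧ (λ i → sgn ℝ (flip2 z (a , b) i j)))      ≡⟨ sym (polymorphism (flip2 z (a , b))) ⟩
      comp (flip2 z (a , b))                                          ∎)
      where
      cols-agree : val ℝ (F b) (λ i → z i b) ≡ val ℝ (F b) (flip ℝ (λ i → z i b) a) →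
        ∀ j → Dec (b ≡ j) → ⟦ F j ⟧ (λ i → sgn ℝ (z i j)) ≡ ⟦ F j ⟧ (λ i → sgn ℝ (flip2 z (a , b) i j))
      cols-agree same j (yes refl) = trans same (eval-congʳ (λ i → cong (sgn ℝ) (sym (flip2-col z a b i))))
      cols-agree same j (no b≢j)   = eval-congʳ (λ i → cong (sgn ℝ) (sym (flip2-other-col z a i b≢j)))

    rowCoeff≡colCoeff : ∀ U → rowCoeff F0 G U ≡ colCoeff G0 F U
    rowCoeff≡colCoeff = evalMatrix-unique _ _ λ z → begin
      evalMatrix (rowCoeff F0 G) (λ i j → sgn ℝ (z i j))            ≡⟨ sym (eval-∘-rows F0 G _) ⟩
      comp z                                                        ≡⟨ polymorphism z ⟩
      ⟦ G0 ⟧ (λ j → ⟦ F j ⟧ (λ i → sgn ℝ (z i j)))                  ≡⟨ eval-∘-cols G0 F _ ⟩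
      evalMatrix (colCoeff G0 F) (λ i j → sgn ℝ (z i j))            ∎

    module Balanced (F-balanced : ∀ j → Balanced ℝ (F j)) (G-balanced : ∀ i → Balanced ℝ (G i)) where

      row⇒col : ∀ U → RowSupported F0 G U → ColSupported G0 F U
      row⇒col U = Equivalence.to (colCoeff≢0⇔ColSupported G0 F F-balanced U)
                ∘ subst (_≢ 0r) (rowCoeff≡colCoeff U)
                ∘ Equivalence.from (rowCoeff≢0⇔RowSupported F0 G G-balanced U)

      col⇒row : ∀ U → ColSupported G0 F U → RowSupported F0 G U
      col⇒row U = Equivalence.to (rowCoeff≢0⇔RowSupported F0 G G-balanced U)
                ∘ subst (_≢ 0r) (sym (rowCoeff≡colCoeff U))
                ∘ Equivalence.from (colCoeff≢0⇔ColSupported G0 F F-balanced U)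

      -- Replace column b by X, then row a′ by T′, then put column b of U back: row a′ keeps c ≠ b,
      -- and every other row is that of U again.
      exchange : ∀ U {a′ b c} X T′ → RowSupported F0 G U → nonempty (column U b) ≡ true →
        supp ℝ (F b) X → a′ ∈ X → supp ℝ (G a′) T′ → b ∈ T′ → c ∈ T′ → c ≢ b →
        Σ[ V ∈ Vec (Subset m) n ] (RowSupported F0 G V × rowsOf U ⊆ rowsOf V × a′ ∈ rowsOf V)
      exchange U {a′} {b} {c} X T′ U-row column≢∅ FX≢0 a′∈X GT′≢0 b∈T′ c∈T′ c≢b = V , V-row , U⊆V , a′∈V
        where
        W  = setColumn U b X
        W′ = W [ a′ ]≔ T′
        V  = setColumn W′ b (column U b)
        U-col = row⇒col U U-row
        W-row = col⇒row W (ColSupported-setColumn G0 F U b X U-col (trans (∈⇒nonempty a′∈X) (sym column≢∅)) FX≢0)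
        b∈Wa′ : b ∈ lookup W a′
        b∈Wa′ = subst (b ∈_) (sym (lookup-setColumn U b X a′))
                  (subst ((lookup U a′ [ b ]≔ lookup X a′) [ b ]=_) ([]=⇒lookup a′∈X) ([]≔-updates (lookup U a′) b))
        W′-row = RowSupported-update F0 G W a′ T′ W-row (trans (∈⇒nonempty b∈T′) (sym (∈⇒nonempty b∈Wa′))) GT′≢0
        a′∈W′b : a′ ∈ column W′ b
        a′∈W′b = ∈-column W′ (subst (b ∈_) (sym (lookup∘update a′ W T′)) b∈T′)
        V-row = col⇒row V (ColSupported-setColumn G0 F W′ b (column U b) (row⇒col W′ W′-row)
                  (trans column≢∅ (sym (∈⇒nonempty a′∈W′b))) (proj₂ U-col (∈-colsOf U column≢∅)))
        c∈Va′ : c ∈ lookup V a′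
        c∈Va′ = subst (c ∈_) (sym (lookup-setColumn W′ b (column U b) a′))
                  ([]≔-minimal (lookup W′ a′) c b c≢b (subst (c ∈_) (sym (lookup∘update a′ W T′)) c∈T′))
        a′∈V : a′ ∈ rowsOf V
        a′∈V = ∈-rowsOf V (∈⇒nonempty c∈Va′)
        U⊆V : rowsOf U ⊆ rowsOf V
        U⊆V {d} d∈U with a′ ≟ d
        ... | yes refl = a′∈V
        ... | no  a′≢d = ∈-rowsOf-cong U V (setColumn-restores U b X a′ T′ a′≢d) d∈U

      module MaximalSupport
        (G-nonconstant : ∀ i → NonConstant ℝ (G i)) (G-twoValuedLike : ∀ i → TwoValuedLike ℝ (G i))
        {S : Subset n} (S-maximal : Maximal (supp ℝ F0) S) where

        supported-row : ∀ i → Σ[ T ∈ Subset m ] (supp ℝ (G i) T × nonempty T ≡ true)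
        supported-row i with nonconstant⇒supported (G i) (G-nonconstant i)
        ... | T , GT≢0 = T , GT≢0 , supp⇒nonempty (G i) (G-balanced i) GT≢0

        ColumnMeetsS : Cell → Set
        ColumnMeetsS (_ , j) = ∃[ a ] (a ∈ S × Z0 (a , j))

        ∈-maximal : ∀ {a′ b} → ColumnMeetsS (a′ , b) → Z0 (a′ , b) → ¬ Dictator ℝ (G a′) → a′ ∈ S
        ∈-maximal {a′} {b} (a , a∈S , ab∈Z0) a′b∈Z0 ¬dictator
          with relevant⇒supported (G a) b (Z0⇒row-relevant ab∈Z0)
             | relevant⇒supported (F b) a′ (Z0⇒col-relevant {a′} {b} a′b∈Z0)
             | proj₂ (G-twoValuedLike a′) ¬dictator b (Z0⇒row-relevant a′b∈Z0)
        ... | T , GT≢0 , b∈T | X , FX≢0 , a′∈X | T′ , GT′≢0 , b∈T′ , 2≤∣T′∣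
          with RowSupported-through F0 G S (proj₁ S-maximal) supported-row a∈S GT≢0 (∈⇒nonempty b∈T)
             | another-element T′ 2≤∣T′∣ b
        ... | U , U-row , U-rows , Ua≡T | c , c∈T′ , c≢b
          with exchange U X T′ U-row (∈⇒nonempty (∈-column U (subst (b ∈_) (sym Ua≡T) b∈T)))
                        FX≢0 a′∈X GT′≢0 b∈T′ c∈T′ c≢b
        ... | V , V-row , U⊆V , a′∈V =
          subst (a′ ∈_) (proj₂ S-maximal (rowsOf V) (proj₁ V-row) (U⊆V ∘ subst (_ ∈_) (sym U-rows))) a′∈V

        ColumnMeetsS-step : ∀ {p q} → Adj p q → ColumnMeetsS p → ColumnMeetsS q
        ColumnMeetsS-step (_ , _ , _ , inj₂ refl) meets = meets
        ColumnMeetsS-step {i , _} (ij∈Z0 , ij′∈Z0 , ij≢ij′ , inj₁ refl) meets =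
          i , ∈-maximal meets ij∈Z0 ¬dictator , ij′∈Z0
          where
          ¬dictator = two-relevant⇒¬dictator (G i) (Z0⇒row-relevant ij∈Z0) (Z0⇒row-relevant ij′∈Z0)
                                             (ij≢ij′ ∘ cong (i ,_))

        ColumnMeetsS-star : ∀ {p q} → Star Adj p q → ColumnMeetsS p → ColumnMeetsS q
        ColumnMeetsS-star ε            = id
        ColumnMeetsS-star (adj ◅ path) = ColumnMeetsS-star path ∘ ColumnMeetsS-step adj

corollary4p8 : (ℝ : Reals) → (n m : ℕ) →
    (F0 : MLPoly ℝ n) → (F : Fin m → MLPoly ℝ n) →
    (G0 : MLPoly ℝ m) → (G : Fin n → MLPoly ℝ m) →
    Polymorphism.IsGenPolymorphism ℝ F0 F G0 G →
    NonConstant ℝ F0 → (∀ j → NonConstant ℝ (F j)) →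
    NonConstant ℝ G0 → (∀ i → NonConstant ℝ (G i)) →
    DependsOnAll ℝ F0 → DependsOnAll ℝ G0 →
    (∀ j → BooleanLike ℝ (F j) × Balanced ℝ (F j)) →
    (∀ i → BooleanLike ℝ (G i) × Balanced ℝ (G i)) →
    (p₀ : Fin n × Fin m) → Polymorphism.Z0 ℝ F0 F G0 G p₀ →
    (S : Subset n) → supp ℝ F0 S →
    (∀ T → supp ℝ F0 T → S ⊆ T → T ≡ S) →
    (∃[ i ] (i ∈ S × Polymorphism.rows ℝ F0 F G0 G p₀ i)) →
    ∀ i → Polymorphism.rows≥2 ℝ F0 F G0 G p₀ i → i ∈ S
corollary4p8 ℝ n m F0 F G0 G polymorphism _ _ _ G-nonconstant _ _ F-props G-props p₀ _ S S-supp S-maximal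
             (i₀ , i₀∈S , j₀ , i₀j₀∈Z0 , p₀↝i₀j₀) i ((j , ij∈Z0 , p₀↝ij) , d , G-deg , 2≤d)
  = ∈-maximal meets ij∈Z0 (deg≥2⇒¬dictator (G i) (proj₁ (proj₁ (G-props i))) G-deg 2≤d)
  where
  open Expansion ℝ
  open Polymorphic ℝ F0 F G0 G
  open Balanced.MaximalSupport polymorphism (proj₂ ∘ F-props) (proj₂ ∘ G-props)
         G-nonconstant (proj₁ ∘ proj₁ ∘ G-props) (S-supp , S-maximal)
  meets : ColumnMeetsS (i , j)
  meets = ColumnMeetsS-star p₀↝ij (ColumnMeetsS-star (reverse Adj-sym p₀↝i₀j₀) (i₀ , i₀∈S , i₀j₀∈Z0))
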